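{- Let $\mathbf{u}$ be an infinite binary word whose set of factors contains infinitely many antipalindromes. Suppose that for some letter $a$ the frequency $\varrho(a)=\lim_{|w|\to\infty}\frac{|w|_a}{|w|}$ (limit over factors $w$ of $\mathbf{u}$) exists. Then both letters $0$ and $1$ have frequency $1/2$ in $\mathbf{u}$.
   Context: $|w|$ is the length of $w$ and $|w|_a$ the number of occurrences of the letter $a$ in $w$. $\mathrm{E}(w_1\cdots w_n)=(1-w_n)\cdots(1-w_1)$; antipalindrome: $\mathrm{E}(w)=w$. -}

module Defs where

open import Data.Bool using (Bool; true; false; not)
open import Data.Nat using (ℕ; zero; suc; _≤_)
open import Data.Integer using (+_)
open import Data.List using (List; []; _∷_; length; reverse; map)
open import Data.Product using (Σ; ∃; _×_)
open import Data.Rational using (ℚ; _/_; 0ℚ; _-_; ∣_∣; _<_)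
open import Relation.Binary.PropositionalEquality using (_≡_)

-- Binary alphabet {0,1}: the letter 0 is `false`, the letter 1 is `true`.
-- An infinite binary word u = u₀u₁u₂⋯ is a function ℕ → Bool.
Word : Set
Word = List Bool

InfWord : Set
InfWord = ℕ → Bool

slice : InfWord → ℕ → ℕ → Word
slice u i zero    = []
slice u i (suc n) = u i ∷ slice u (suc i) n

IsFactor : InfWord → Word → Set
IsFactor u w = ∃ λ i → slice u i (length w) ≡ w

count : Bool → Word → ℕ
count a [] = 0
count true  (true  ∷ w) = suc (count true w)
count true  (false ∷ w) = count true w
count false (true  ∷ w) = count false w
count false (false ∷ w) = suc (count false w)

E : Word → Word
E w = reverse (map not w)

IsAntipalindrome : Word → Set
IsAntipalindrome w = E w ≡ w

-- |w|_a / |w|  (the empty word gets 0; irrelevant for limits)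
ratio : Bool → Word → ℚ
ratio a []      = 0ℚ
ratio a (x ∷ w) = (+ count a (x ∷ w)) / length (x ∷ w)

-- The set of factors of u contains infinitely many antipalindromes
-- (equivalently, antipalindromic factors of unbounded length).
InfinitelyManyAntipalindromes : InfWord → Set
InfinitelyManyAntipalindromes u =
  ∀ n → ∃ λ w → IsFactor u w × IsAntipalindrome w × n ≤ length w

-- ϱ(a) = lim_{|w|→∞, w factor of u} |w|_a/|w| exists (Cauchy criterion,
-- since the limit is a real number and need not be rational).
FrequencyExists : InfWord → Bool → Set
FrequencyExists u a =
  ∀ ε → 0ℚ < ε → ∃ λ N → ∀ v w → IsFactor u v → IsFactor u w →
    N ≤ length v → N ≤ length w → ∣ ratio a v - ratio a w ∣ < ε

FrequencyIs : InfWord → Bool → ℚ → Set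
FrequencyIs u a ρ =
  ∀ ε → 0ℚ < ε → ∃ λ N → ∀ w → IsFactor u w →
    N ≤ length w → ∣ ratio a w - ρ ∣ < ε

-- A nonempty antipalindrome w = E(w) contains as many 0s as 1s, because E
-- exchanges the two letters and reversal preserves letter counts; so every
-- letter has ratio exactly 1/2 in it. Arbitrarily long such factors exist, hence
-- if the frequency of a exists (Cauchy criterion) it must be 1/2, and the
-- frequency of the other letter is then 1 - 1/2 = 1/2.
module Submission where

open import Defs
open import Data.Bool using (Bool; true; false; not)
open import Data.Nat as ℕ using (suc; _≤_; s≤s)
open import Data.Nat.Properties using (+-comm; +-suc; m≤n⇒m≤1+n)
open import Data.Integer as ℤ using (+_)
import Data.Integer.Properties as ℤ
open import Data.Integer.Solver renaming (module +-*-Solver to ℤ-Solver)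
open import Data.List using ([]; _∷_; length; reverse; map; _++_; [_])
open import Data.List.Properties using (unfold-reverse)
open import Data.Product using (∃; _×_; _,_)
open import Data.Rational using (0ℚ; 1ℚ; ½; _/_; _+_; _-_; _*_; ∣_∣; _<_; toℚᵘ; fromℚᵘ)
open import Data.Rational.Properties
  using (toℚᵘ-injective; toℚᵘ-homo-+; toℚᵘ-fromℚᵘ; fromℚᵘ-cong; +-inverseʳ; ∣-p∣≡∣p∣)
open import Data.Rational.Solver renaming (module +-*-Solver to ℚ-Solver)
open import Data.Rational.Unnormalised as ℚᵘ using (mkℚᵘ; *≡*)
import Data.Rational.Unnormalised.Properties as ℚᵘ
open import Relation.Binary.PropositionalEquality hiding ([_])

count-++ : ∀ b xs ys → count b (xs ++ ys) ≡ count b xs ℕ.+ count b ys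
count-++ b []           ys = refl
count-++ true  (true  ∷ xs) ys = cong suc (count-++ true xs ys)
count-++ true  (false ∷ xs) ys = count-++ true xs ys
count-++ false (true  ∷ xs) ys = count-++ false xs ys
count-++ false (false ∷ xs) ys = cong suc (count-++ false xs ys)

count-reverse : ∀ b xs → count b (reverse xs) ≡ count b xs
count-reverse b []       = refl
count-reverse b (x ∷ xs) = begin
  count b (reverse (x ∷ xs))             ≡⟨ cong (count b) (unfold-reverse x xs) ⟩
  count b (reverse xs ++ [ x ])          ≡⟨ count-++ b (reverse xs) [ x ] ⟩
  count b (reverse xs) ℕ.+ count b [ x ] ≡⟨ cong (ℕ._+ count b [ x ]) (count-reverse b xs) ⟩
  count b xs ℕ.+ count b [ x ]           ≡⟨ +-comm (count b xs) (count b [ x ]) ⟩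
  count b [ x ] ℕ.+ count b xs           ≡⟨ count-++ b [ x ] xs ⟨
  count b (x ∷ xs)                       ∎
  where open ≡-Reasoning

count-map-not : ∀ b xs → count b (map not xs) ≡ count (not b) xs
count-map-not b []                = refl
count-map-not true  (true  ∷ xs) = count-map-not true xs
count-map-not true  (false ∷ xs) = cong suc (count-map-not true xs)
count-map-not false (true  ∷ xs) = cong suc (count-map-not false xs)
count-map-not false (false ∷ xs) = count-map-not false xs

count-E : ∀ b w → count b (E w) ≡ count (not b) w
count-E b w = trans (count-reverse b (map not w)) (count-map-not b w)

count+count-not≡length : ∀ b w → count b w ℕ.+ count (not b) w ≡ length w
count+count-not≡length b []               = refl
count+count-not≡length true  (true  ∷ w) = cong suc (count+count-not≡length true w)
count+count-not≡length true  (false ∷ w) = trans (+-suc _ _) (cong suc (count+count-not≡length true w))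
count+count-not≡length false (true  ∷ w) = trans (+-suc _ _) (cong suc (count+count-not≡length false w))
count+count-not≡length false (false ∷ w) = cong suc (count+count-not≡length false w)

antipalindrome⇒count≡count-not : ∀ b {w} → IsAntipalindrome w → count b w ≡ count (not b) w
antipalindrome⇒count≡count-not b {w} pal = trans (cong (count b) (sym pal)) (count-E b w)

p/n+q/n≡[p+q]/n : ∀ p q m → (+ p) / suc m + (+ q) / suc m ≡ (+ (p ℕ.+ q)) / suc m
p/n+q/n≡[p+q]/n p q m = toℚᵘ-injective (begin
  toℚᵘ (fromℚᵘ x + fromℚᵘ y)            ≈⟨ toℚᵘ-homo-+ (fromℚᵘ x) (fromℚᵘ y) ⟩
  toℚᵘ (fromℚᵘ x) ℚᵘ.+ toℚᵘ (fromℚᵘ y)  ≈⟨ ℚᵘ.+-cong (toℚᵘ-fromℚᵘ x) (toℚᵘ-fromℚᵘ y) ⟩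
  x ℚᵘ.+ y                               ≈⟨ *≡* cross-multiplied ⟩
  mkℚᵘ (+ (p ℕ.+ q)) m                   ≈⟨ toℚᵘ-fromℚᵘ (mkℚᵘ (+ (p ℕ.+ q)) m) ⟨
  toℚᵘ (fromℚᵘ (mkℚᵘ (+ (p ℕ.+ q)) m))  ∎)
  where
  open ℚᵘ.≃-Reasoning
  x = mkℚᵘ (+ p) m
  y = mkℚᵘ (+ q) m
  n = suc m
  cross-multiplied : (+ p ℤ.* + n ℤ.+ + q ℤ.* + n) ℤ.* + n ≡ + (p ℕ.+ q) ℤ.* + (n ℕ.* n)
  cross-multiplied =
    trans (solve 3 (λ p q n → (p :* n :+ q :* n) :* n := (p :+ q) :* (n :* n)) refl (+ p) (+ q) (+ n))
          (sym (cong₂ ℤ._*_ (ℤ.pos-+ p q) (ℤ.pos-* n n)))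
    where open ℤ-Solver

n/n≡1 : ∀ m → (+ suc m) / suc m ≡ 1ℚ
n/n≡1 m = fromℚᵘ-cong {mkℚᵘ (+ suc m) m} {mkℚᵘ (+ 1) 0}
  (*≡* (trans (ℤ.*-identityʳ (+ suc m)) (sym (ℤ.*-identityˡ (+ suc m)))))

p≡q∧p+q≡1⇒p≡½ : ∀ {p q} → p ≡ q → p + q ≡ 1ℚ → p ≡ ½
p≡q∧p+q≡1⇒p≡½ {p} {q} p≡q p+q≡1 = begin
  p                               ≡⟨ solve 2 (λ p q → p := (p :+ q) :* con ½ :+ (p :- q) :* con ½) refl p q ⟩
  (p + q) * ½ + (p - q) * ½       ≡⟨ cong₂ (λ s d → s * ½ + d * ½) p+q≡1 p-q≡0 ⟩
  1ℚ * ½ + 0ℚ * ½                 ≡⟨⟩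
  ½                               ∎
  where
  open ≡-Reasoning
  open ℚ-Solver
  p-q≡0 : p - q ≡ 0ℚ
  p-q≡0 = trans (cong (λ r → p - r) (sym p≡q)) (+-inverseʳ p)

p+q≡1⇒q≡1-p : ∀ {p q} → p + q ≡ 1ℚ → q ≡ 1ℚ - p
p+q≡1⇒q≡1-p {p} {q} p+q≡1 =
  trans (solve 2 (λ p q → q := (p :+ q) :- p) refl p q) (cong (_- p) p+q≡1)
  where open ℚ-Solver

∣[1-p]-[1-q]∣≡∣p-q∣ : ∀ p q → ∣ (1ℚ - p) - (1ℚ - q) ∣ ≡ ∣ p - q ∣
∣[1-p]-[1-q]∣≡∣p-q∣ p q =
  trans (cong ∣_∣ (solve 2 (λ p q → (con 1ℚ :- p) :- (con 1ℚ :- q) := :- (p :- q)) refl p q))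
        (∣-p∣≡∣p∣ (p - q))
  where open ℚ-Solver

ratio-cong : ∀ a b w → count a w ≡ count b w → ratio a w ≡ ratio b w
ratio-cong a b []      _  = refl
ratio-cong a b (x ∷ w) eq = cong (λ c → (+ c) / length (x ∷ w)) eq

ratio+ratio-not≡1 : ∀ b x w → ratio b (x ∷ w) + ratio (not b) (x ∷ w) ≡ 1ℚ
ratio+ratio-not≡1 b x w = begin
  (+ count b (x ∷ w)) / suc (length w) + (+ count (not b) (x ∷ w)) / suc (length w)
    ≡⟨ p/n+q/n≡[p+q]/n (count b (x ∷ w)) (count (not b) (x ∷ w)) (length w) ⟩
  (+ (count b (x ∷ w) ℕ.+ count (not b) (x ∷ w))) / suc (length w)
    ≡⟨ cong (λ n → (+ n) / suc (length w)) (count+count-not≡length b (x ∷ w)) ⟩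
  (+ suc (length w)) / suc (length w)
    ≡⟨ n/n≡1 (length w) ⟩
  1ℚ ∎
  where open ≡-Reasoning

antipalindrome⇒ratio≡½ : ∀ b x w → IsAntipalindrome (x ∷ w) → ratio b (x ∷ w) ≡ ½
antipalindrome⇒ratio≡½ b x w pal =
  p≡q∧p+q≡1⇒p≡½ (ratio-cong b (not b) (x ∷ w) (antipalindrome⇒count≡count-not b pal)) (ratio+ratio-not≡1 b x w)

module _ {u : InfWord} where

  frequencyIs-not : ∀ a ρ → FrequencyIs u a ρ → FrequencyIs u (not a) (1ℚ - ρ)
  -- The threshold is raised by one because ratio [] = 0 breaks the complement identity.
  frequencyIs-not a ρ ϱ ε ε>0 with ϱ ε ε>0
  ... | N , close = suc N , close′
    where
    close′ : ∀ w → IsFactor u w → suc N ≤ length w → ∣ ratio (not a) w - (1ℚ - ρ) ∣ < ε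
    close′ (x ∷ w) fw (s≤s N≤) = subst (_< ε) (sym (begin
      ∣ ratio (not a) (x ∷ w) - (1ℚ - ρ) ∣
        ≡⟨ cong (λ r → ∣ r - (1ℚ - ρ) ∣) (p+q≡1⇒q≡1-p {ratio a (x ∷ w)} (ratio+ratio-not≡1 a x w)) ⟩
      ∣ (1ℚ - ratio a (x ∷ w)) - (1ℚ - ρ) ∣
        ≡⟨ ∣[1-p]-[1-q]∣≡∣p-q∣ (ratio a (x ∷ w)) ρ ⟩
      ∣ ratio a (x ∷ w) - ρ ∣ ∎))
      (close (x ∷ w) fw (m≤n⇒m≤1+n N≤))
      where open ≡-Reasoning

  frequencyExists⇒frequencyIs : ∀ {a ρ} → FrequencyExists u a →
    (∀ n → ∃ λ v → IsFactor u v × n ≤ length v × ratio a v ≡ ρ) → FrequencyIs u a ρ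
  frequencyExists⇒frequencyIs {a} fe witness ε ε>0 with fe ε ε>0
  ... | N , cauchy with witness N
  ...   | v , fv , N≤v , ratio≡ρ = N , λ w fw N≤w →
    subst (λ r → ∣ ratio a w - r ∣ < ε) ratio≡ρ (cauchy w v fw fv N≤w N≤v)

  antipalindromes⇒frequency≡½ : InfinitelyManyAntipalindromes u →
    ∀ a → FrequencyExists u a → FrequencyIs u a ½
  antipalindromes⇒frequency≡½ ap a fe = frequencyExists⇒frequencyIs fe long-antipalindrome
    where
    long-antipalindrome : ∀ n → ∃ λ v → IsFactor u v × n ≤ length v × ratio a v ≡ ½
    -- The empty word is an antipalindrome of ratio 0, hence the request for length suc n.
    long-antipalindrome n with ap (suc n)
    ... | x ∷ w , fv , pal , s≤s n≤ =
      x ∷ w , fv , m≤n⇒m≤1+n n≤ , antipalindrome⇒ratio≡½ a x w pal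

lemma32 : (u : InfWord) → InfinitelyManyAntipalindromes u →
            (a : Bool) → FrequencyExists u a →
            FrequencyIs u false ½ × FrequencyIs u true ½
lemma32 u ap a fe = both a (antipalindromes⇒frequency≡½ ap a fe)
  where
  -- 1ℚ - ½ normalises to ½.
  both : ∀ a → FrequencyIs u a ½ → FrequencyIs u false ½ × FrequencyIs u true ½
  both false ϱ = ϱ , frequencyIs-not false ½ ϱ
  both true  ϱ = frequencyIs-not true ½ ϱ , ϱ
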